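{- Let $L$ be a proper unimodular $\mathbb{Z}_2$-lattice of rank $4$. Then (i) $L$ is $\mathbb{Z}_2$-universal; (ii) $L$ is primitively $\mathbb{Z}_2$-universal if and only if $\{4,8\}\subseteq q^*(L)$.
   Context: A $\mathbb{Z}_2$-lattice is a finitely generated $\mathbb{Z}_2$-submodule of a nondegenerate quadratic space over $\mathbb{Q}_2$ with quadratic map $q$. A proper unimodular $\mathbb{Z}_2$-lattice of rank $n$ is one having an orthogonal basis $v_1,\ldots,v_n$ with all $q(v_i)\in\mathbb{Z}_2^\times$. A vector $v\in L$ is primitive if $\{\alpha\in\mathbb{Q}_2:\alpha v\in L\}=\mathbb{Z}_2$; $q^*(L)=\{q(v):v\in L\text{ primitive}\}$. $L$ is $\mathbb{Z}_2$-universal if $q(L)=\mathbb{Z}_2$, and primitively $\mathbb{Z}_2$-universal if every nonzero $\alpha\in\mathbb{Z}_2$ lies in $q^*(L)$. -}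

module Defs where

open import Data.Nat as ℕ using (ℕ; zero; suc; ⌊_/2⌋)
open import Data.Bool using (Bool; true; false; not)
open import Data.Fin using (Fin; zero; suc)
open import Data.Product using (Σ; ∃; _×_; _,_)
open import Relation.Binary.PropositionalEquality using (_≡_)
open import Relation.Nullary using (¬_)

-- The 2-adic integers ℤ₂, as streams of binary digits:
-- a : ℤ₂ stands for Σᵢ (a i) 2ⁱ.  Every stream is a 2-adic integer and
-- distinct streams are distinct 2-adic integers.

ℤ₂ : Set
ℤ₂ = ℕ → Bool

infix 4 _≈_
_≈_ : ℤ₂ → ℤ₂ → Set
a ≈ b = ∀ i → a i ≡ b i

isOdd : ℕ → Bool
isOdd zero    = false
isOdd (suc n) = not (isOdd n)

bits : ℕ → ℕ → Bool
bits n zero    = isOdd n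
bits n (suc i) = bits ⌊ n /2⌋ i

b2n : Bool → ℕ
b2n true  = 1
b2n false = 0

trunc : ℤ₂ → ℕ → ℕ
trunc a zero    = 0
trunc a (suc k) = b2n (a 0) ℕ.+ 2 ℕ.* trunc (λ i → a (suc i)) k

fromℕ : ℕ → ℤ₂
fromℕ n = bits n

infixl 6 _+_
infixl 7 _*_
_+_ : ℤ₂ → ℤ₂ → ℤ₂
(a + b) i = bits (trunc a (suc i) ℕ.+ trunc b (suc i)) i

_*_ : ℤ₂ → ℤ₂ → ℤ₂
(a * b) i = bits (trunc a (suc i) ℕ.* trunc b (suc i)) i

IsUnit : ℤ₂ → Set
IsUnit a = a 0 ≡ true

-- nonzero, in the (classically equivalent) positive form: some digit is 1
NonZero₂ : ℤ₂ → Set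
NonZero₂ a = ∃ λ i → a i ≡ true

-- A proper unimodular ℤ₂-lattice of rank 4, written in its orthogonal
-- basis v₁..v₄ with unit values u i = q(vᵢ): L = ℤ₂⁴ with
--   q(x) = u₀ x₀² + u₁ x₁² + u₂ x₂² + u₃ x₃².

Units4 : Set
Units4 = Σ (Fin 4 → ℤ₂) λ u → ∀ i → IsUnit (u i)

Vec4 : Set
Vec4 = Fin 4 → ℤ₂

qform : (Fin 4 → ℤ₂) → Vec4 → ℤ₂
qform u x = u zero * x zero * x zero
          + u (suc zero) * x (suc zero) * x (suc zero)
          + u (suc (suc zero)) * x (suc (suc zero)) * x (suc (suc zero))
          + u (suc (suc (suc zero))) * x (suc (suc (suc zero))) * x (suc (suc (suc zero)))

-- x = Σ xᵢ vᵢ is primitive iff not all coordinates lie in 2ℤ₂,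
-- i.e. some coordinate is a unit.
Primitive : Vec4 → Set
Primitive x = ∃ λ (i : Fin 4) → IsUnit (x i)

Represents : (Fin 4 → ℤ₂) → ℤ₂ → Set
Represents u α = ∃ λ (x : Vec4) → qform u x ≈ α

-- α ∈ q*(L)
PrimRepresents : (Fin 4 → ℤ₂) → ℤ₂ → Set
PrimRepresents u α = ∃ λ (x : Vec4) → Primitive x × qform u x ≈ α

Universal : (Fin 4 → ℤ₂) → Set
Universal u = ∀ (α : ℤ₂) → Represents u α

PrimUniversal : (Fin 4 → ℤ₂) → Set
PrimUniversal u = ∀ (α : ℤ₂) → NonZero₂ α → PrimRepresents u α

-- Everything is reduced to arithmetic of natural numbers modulo powers of two.  A 2-adic
-- integer is a stream of binary digits; its truncation to N digits is its residue modulo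
-- 2^N, sums and products are computed on truncations (`trunc-+`, `trunc-*`), and x
-- represents α iff the truncations of x solve q(X) ≡ α modulo every 2^N
-- (`represents-if-solves`).  Hensel's lemma (`HenselLift`) lifts a solution modulo 8
-- with an odd coordinate to an exact primitive representation: each step corrects one
-- binary digit (`hensel-step`), and the representing vector is the 2-adic limit of the
-- approximations (`lim`).  That every α ≢ 0 (mod 4) has such a solution modulo 8 is a
-- finite check over residues modulo 8 (`check8`).  Then
--  (i)  α ≡ 0 (mod 4) is represented by 2y where q(y) = α/4 (`Descent`), and
--  (ii) α ≡ 0 (mod 4) is congruent modulo 8 to 4 or to 8, so primitive representations
--       of 4 and 8 provide the solutions modulo 8 to be lifted (`primitive-from-4-and-8`).
module Submission where

open import Data.Bool using (Bool; true; false; not; _∨_; T)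
open import Data.Bool.Properties using (¬-not; not-involutive)
open import Data.Fin using (Fin; zero; suc)
open import Data.Fin.Properties using (any?) renaming (_≟_ to _≟ᶠ_)
open import Data.List using (List; []; _∷_; concatMap; map)
open import Data.List.Relation.Unary.Any using (Any; satisfied) renaming (any? to any-in?)
open import Data.Nat using (ℕ; zero; suc; _+_; _*_; _^_; _≤_; _<_; z≤n; s≤s; z<s; s<s; ⌊_/2⌋; NonZero)
open import Data.Nat.DivMod
open import Data.Nat.Divisibility using (_∣_; m∣m*n)
open import Data.Nat.Properties
open import Data.Nat.Tactic.RingSolver using (solve-∀)
open import Data.Product using (Σ; ∃; _×_; _,_; proj₁; proj₂)
open import Data.Sum using (_⊎_; inj₁; inj₂)
open import Data.Unit using (tt)
open import Data.Vec.Functional using (updateAt)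
open import Data.Vec.Functional.Properties using (updateAt-updates; updateAt-minimal)
open import Function using (_∘_)
open import Function.Bundles using (_⇔_; mk⇔)
open import Relation.Binary.PropositionalEquality
open import Relation.Nullary using (¬_; Dec; yes; no)
open import Relation.Nullary.Decidable using (_×-dec_; _→-dec_; T?; from-yes)

open import Defs hiding (_+_; _*_)
open import Defs using () renaming (_+_ to _+₂_; _*_ to _*₂_)

-- Powers of two are opaque, so that `2^ suc n` does not unfold into a product
-- and instance search can supply the `NonZero (2^ n)` needed by `_%_`.
opaque
  2^_ : ℕ → ℕ
  2^ n = 2 ^ n

  2^-zero : 2^ 0 ≡ 1
  2^-zero = refl

  2^-suc : ∀ n → 2^ suc n ≡ 2 * 2^ n
  2^-suc n = refl

  2^2≡4 : 2^ 2 ≡ 4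
  2^2≡4 = refl

  2^3≡8 : 2^ 3 ≡ 8
  2^3≡8 = refl

  2^4≡16 : 2^ 4 ≡ 16
  2^4≡16 = refl

  2^-+ : ∀ m n → 2^ (m + n) ≡ 2^ m * 2^ n
  2^-+ m n = ^-distribˡ-+-* 2 m n

  2^-nonZero : ∀ n → NonZero (2^ n)
  2^-nonZero n = m^n≢0 2 n

instance
  2^-NonZero : ∀ {n} → NonZero (2^ n)
  2^-NonZero {n} = 2^-nonZero n

2^-mono-∣ : ∀ {m n} → m ≤ n → 2^ m ∣ 2^ n
2^-mono-∣ {m} m≤n with m≤n⇒∃[o]m+o≡n m≤n
... | d , refl = subst (2^ m ∣_) (sym (2^-+ m d)) (m∣m*n (2^ d))

-- Congruence modulo 2^N.  It is a record rather than an abbreviation so that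
-- a, b and N stay inferable from the type (`_%_` is not injective).
infix 4 _≡_[2^_]
record _≡_[2^_] (a b N : ℕ) : Set where
  constructor mod-eq
  field residue : a % 2^ N ≡ b % 2^ N
open _≡_[2^_] public

module _ {N : ℕ} where

  mod-refl : ∀ {a} → a ≡ a [2^ N ]
  mod-refl = mod-eq refl

  mod-≡ : ∀ {a b} → a ≡ b → a ≡ b [2^ N ]
  mod-≡ refl = mod-refl

  mod-sym : ∀ {a b} → a ≡ b [2^ N ] → b ≡ a [2^ N ]
  mod-sym (mod-eq e) = mod-eq (sym e)

  mod-trans : ∀ {a b c} → a ≡ b [2^ N ] → b ≡ c [2^ N ] → a ≡ c [2^ N ]
  mod-trans (mod-eq e) (mod-eq f) = mod-eq (trans e f)

  mod-+ : ∀ {a a′ b b′} → a ≡ a′ [2^ N ] → b ≡ b′ [2^ N ] → a + b ≡ a′ + b′ [2^ N ]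
  mod-+ {a} {a′} {b} {b′} (mod-eq e) (mod-eq f) = mod-eq (begin
    (a + b) % 2^ N                   ≡⟨ %-distribˡ-+ a b (2^ N) ⟩
    (a % 2^ N + b % 2^ N) % 2^ N     ≡⟨ cong₂ (λ x y → (x + y) % 2^ N) e f ⟩
    (a′ % 2^ N + b′ % 2^ N) % 2^ N   ≡⟨ %-distribˡ-+ a′ b′ (2^ N) ⟨
    (a′ + b′) % 2^ N                 ∎)
    where open ≡-Reasoning

  mod-* : ∀ {a a′ b b′} → a ≡ a′ [2^ N ] → b ≡ b′ [2^ N ] → a * b ≡ a′ * b′ [2^ N ]
  mod-* {a} {a′} {b} {b′} (mod-eq e) (mod-eq f) = mod-eq (begin
    (a * b) % 2^ N                   ≡⟨ %-distribˡ-* a b (2^ N) ⟩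
    (a % 2^ N * (b % 2^ N)) % 2^ N   ≡⟨ cong₂ (λ x y → (x * y) % 2^ N) e f ⟩
    (a′ % 2^ N * (b′ % 2^ N)) % 2^ N ≡⟨ %-distribˡ-* a′ b′ (2^ N) ⟨
    (a′ * b′) % 2^ N                 ∎)
    where open ≡-Reasoning

  mod-% : ∀ a → a % 2^ N ≡ a [2^ N ]
  mod-% a = mod-eq (m%n%n≡m%n a (2^ N))

  mod-add-2^ : ∀ a → a + 2^ N ≡ a [2^ N ]
  mod-add-2^ a = mod-eq ([m+n]%n≡m%n a (2^ N))

  mod-add-multiple : ∀ a e → a + 2^ N * e ≡ a [2^ N ]
  mod-add-multiple a e = mod-eq (trans (cong (λ t → (a + t) % 2^ N) (*-comm (2^ N) e)) ([m+kn]%n≡m%n a e (2^ N)))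

  mod-eq? : ∀ a b → Dec (a ≡ b [2^ N ])
  mod-eq? a b with a % 2^ N ≟ b % 2^ N
  ... | yes e = yes (mod-eq e)
  ... | no ¬e = no (λ ab → ¬e (residue ab))

mod-weaken : ∀ {M N a b} → M ≤ N → a ≡ b [2^ N ] → a ≡ b [2^ M ]
mod-weaken {M} {N} {a} {b} M≤N (mod-eq e) = mod-eq (begin
  a % 2^ M            ≡⟨ m∣n⇒o%n%m≡o%m (2^ M) (2^ N) a (2^-mono-∣ M≤N) ⟨
  a % 2^ N % 2^ M     ≡⟨ cong (_% 2^ M) e ⟩
  b % 2^ N % 2^ M     ≡⟨ m∣n⇒o%n%m≡o%m (2^ M) (2^ N) b (2^-mono-∣ M≤N) ⟩
  b % 2^ M            ∎)
  where open ≡-Reasoning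

mod-zero : ∀ a b → a ≡ b [2^ 0 ]
mod-zero a b = mod-eq (trans (%-congʳ 2^-zero) (trans (n%1≡0 a) (sym (trans (%-congʳ 2^-zero) (n%1≡0 b)))))

mod-4* : ∀ {M a b} → a ≡ b [2^ M ] → 4 * a ≡ 4 * b [2^ (2 + M) ]
mod-4* {M} {a} {b} (mod-eq e) = mod-eq (trans (scale a) (trans (cong (_* 4) e) (sym (scale b))))
  where
  instance
    2^M*4≢0 : NonZero (2^ M * 4)
    2^M*4≢0 = m*n≢0 (2^ M) 4
  2^2+M : 2^ (2 + M) ≡ 2^ M * 4
  2^2+M = trans (2^-+ 2 M) (trans (cong (_* 2^ M) 2^2≡4) (*-comm 4 (2^ M)))
  scale : ∀ z → (4 * z) % 2^ (2 + M) ≡ z % 2^ M * 4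
  scale z = trans (%-congʳ 2^2+M) (trans (cong (_% (2^ M * 4)) (*-comm 4 z)) (sym (m%n*o≡m*o%[n*o] z (2^ M) 4)))

parity-split : ∀ h → h ≡ b2n (isOdd h) + 2 * ⌊ h /2⌋
parity-split zero          = refl
parity-split (suc zero)    = refl
parity-split (suc (suc h)) rewrite not-involutive (isOdd h) =
  trans (cong (2 +_) (parity-split h)) (shift (b2n (isOdd h)) ⌊ h /2⌋)
  where shift : ∀ b q → 2 + (b + 2 * q) ≡ b + 2 * suc q
        shift = solve-∀

b2n≤1 : ∀ b → b2n b ≤ 1
b2n≤1 true  = ≤-refl
b2n≤1 false = z≤n

b2n-injective : ∀ {b c} → b2n b ≡ b2n c → b ≡ c
b2n-injective {true}  {true}  _ = refl
b2n-injective {false} {false} _ = refl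

mod-2^suc : ∀ h N → h % 2^ suc N ≡ b2n (isOdd h) + 2 * (⌊ h /2⌋ % 2^ N)
mod-2^suc h N = begin
  h % 2^ suc N                         ≡⟨ %-congʳ (trans (2^-suc N) (*-comm 2 (2^ N))) ⟩
  h % (2^ N * 2)                       ≡⟨ cong (_% (2^ N * 2)) (trans (parity-split h) (+-comm b (2 * q))) ⟩
  (2 * q + b) % (2^ N * 2)             ≡⟨ cong (λ t → (t + b) % (2^ N * 2)) (*-comm 2 q) ⟩
  (q * 2 + b) % (2^ N * 2)             ≡⟨ [m*n+o]%[p*n]≡[m*n]%[p*n]+o q (2^ N) (s≤s (b2n≤1 (isOdd h))) ⟩
  q * 2 % (2^ N * 2) + b               ≡⟨ cong (_+ b) (m%n*o≡m*o%[n*o] q (2^ N) 2) ⟨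
  q % 2^ N * 2 + b                     ≡⟨ trans (+-comm _ b) (cong (b +_) (*-comm (q % 2^ N) 2)) ⟩
  b + 2 * (q % 2^ N)                   ∎
  where
  open ≡-Reasoning
  instance
    2^N*2≢0 : NonZero (2^ N * 2)
    2^N*2≢0 = m*n≢0 (2^ N) 2
  b q : ℕ
  b = b2n (isOdd h)
  q = ⌊ h /2⌋

trunc-bits : ∀ h N → trunc (bits h) N ≡ h % 2^ N
trunc-bits h zero    = sym (trans (%-congʳ 2^-zero) (n%1≡0 h))
trunc-bits h (suc N) = trans (cong (λ t → b2n (isOdd h) + 2 * t) (trunc-bits ⌊ h /2⌋ N)) (sym (mod-2^suc h N))

trunc-suc : ∀ a N → trunc a (suc N) ≡ trunc a N + 2^ N * b2n (a N)
trunc-suc a zero    = trans (+-identityʳ _) (sym (trans (cong (λ t → t * b2n (a 0)) 2^-zero) (+-identityʳ _)))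
trunc-suc a (suc N) = begin
  b2n (a 0) + 2 * trunc a′ (suc N)                         ≡⟨ cong (λ t → b2n (a 0) + 2 * t) (trunc-suc a′ N) ⟩
  b2n (a 0) + 2 * (trunc a′ N + 2^ N * b2n (a (suc N)))    ≡⟨ regroup (b2n (a 0)) (trunc a′ N) (2^ N) (b2n (a (suc N))) ⟩
  b2n (a 0) + 2 * trunc a′ N + 2 * 2^ N * b2n (a (suc N))  ≡⟨ cong (λ t → trunc a (suc N) + t * b2n (a (suc N))) (2^-suc N) ⟨
  trunc a (suc N) + 2^ suc N * b2n (a (suc N))             ∎
  where
  open ≡-Reasoning
  a′ : ℤ₂
  a′ i = a (suc i)
  regroup : ∀ b t p c → b + 2 * (t + p * c) ≡ b + 2 * t + 2 * p * c
  regroup = solve-∀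

trunc-< : ∀ a N → trunc a N < 2^ N
trunc-< a zero    = subst (0 <_) (sym 2^-zero) z<s
trunc-< a (suc N) = begin-strict
  trunc a (suc N)                       ≡⟨ trunc-suc a N ⟩
  trunc a N + 2^ N * b2n (a N)          <⟨ +-monoˡ-< _ (trunc-< a N) ⟩
  2^ N + 2^ N * b2n (a N)               ≤⟨ +-monoʳ-≤ (2^ N) (*-monoʳ-≤ (2^ N) (b2n≤1 (a N))) ⟩
  2^ N + 2^ N * 1                       ≡⟨ solve2 (2^ N) ⟩
  2 * 2^ N                              ≡⟨ 2^-suc N ⟨
  2^ suc N                              ∎
  where
  open ≤-Reasoning
  solve2 : ∀ p → p + p * 1 ≡ 2 * p
  solve2 = solve-∀

trunc-mod : ∀ a N → trunc a N % 2^ N ≡ trunc a N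
trunc-mod a N = m<n⇒m%n≡m (trunc-< a N)

trunc-eq : ∀ {a b} N → trunc a N ≡ trunc b N [2^ N ] → trunc a N ≡ trunc b N
trunc-eq {a} {b} N e = trans (sym (trunc-mod a N)) (trans (residue e) (trunc-mod b N))

trunc-local : ∀ {a b} N → (∀ i → i < N → a i ≡ b i) → trunc a N ≡ trunc b N
trunc-local zero    same = refl
trunc-local (suc N) same =
  cong₂ (λ x y → b2n x + 2 * y) (same 0 z<s) (trunc-local N (λ i i<N → same (suc i) (s<s i<N)))

trunc-injective : ∀ {a b} → (∀ N → trunc a N ≡ trunc b N) → a ≈ b
trunc-injective {a} {b} same i = b2n-injective (*-cancelˡ-≡ _ _ (2^ i) (+-cancelˡ-≡ (trunc a i) _ _ (begin
  trunc a i + 2^ i * b2n (a i)  ≡⟨ trunc-suc a i ⟨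
  trunc a (suc i)               ≡⟨ same (suc i) ⟩
  trunc b (suc i)               ≡⟨ trunc-suc b i ⟩
  trunc b i + 2^ i * b2n (b i)  ≡⟨ cong (_+ 2^ i * b2n (b i)) (same i) ⟨
  trunc a i + 2^ i * b2n (b i)  ∎)))
  where open ≡-Reasoning

digit-split : ∀ h N → h % 2^ suc N ≡ h % 2^ N + 2^ N * b2n (bits h N)
digit-split h N = trans (sym (trunc-bits h (suc N)))
  (trans (trunc-suc (bits h) N) (cong (_+ 2^ N * b2n (bits h N)) (trunc-bits h N)))

digit-cong : ∀ {a b N} → a ≡ b [2^ suc N ] → bits a N ≡ bits b N
digit-cong {a} {b} {N} ab = b2n-injective (*-cancelˡ-≡ _ _ (2^ N) (+-cancelˡ-≡ (a % 2^ N) _ _ (begin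
  a % 2^ N + 2^ N * b2n (bits a N)  ≡⟨ digit-split a N ⟨
  a % 2^ suc N                      ≡⟨ residue ab ⟩
  b % 2^ suc N                      ≡⟨ digit-split b N ⟩
  b % 2^ N + 2^ N * b2n (bits b N)  ≡⟨ cong (_+ 2^ N * b2n (bits b N)) (residue (mod-weaken (n≤1+n N) ab)) ⟨
  a % 2^ N + 2^ N * b2n (bits b N)  ∎)))
  where open ≡-Reasoning

mod-suc : ∀ {a b N} → a ≡ b [2^ N ] → bits a N ≡ bits b N → a ≡ b [2^ suc N ]
mod-suc {a} {b} {N} ab same = mod-eq (begin
  a % 2^ suc N                      ≡⟨ digit-split a N ⟩
  a % 2^ N + 2^ N * b2n (bits a N)  ≡⟨ cong₂ (λ r c → r + 2^ N * b2n c) (residue ab) same ⟩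
  b % 2^ N + 2^ N * b2n (bits b N)  ≡⟨ digit-split b N ⟨
  b % 2^ suc N                      ∎)
  where open ≡-Reasoning

⌊+2*/2⌋ : ∀ a m → ⌊ a + 2 * m /2⌋ ≡ ⌊ a /2⌋ + m
⌊+2*/2⌋ a zero    = trans (cong ⌊_/2⌋ (+-identityʳ a)) (sym (+-identityʳ _))
⌊+2*/2⌋ a (suc m) = begin
  ⌊ a + 2 * suc m /2⌋          ≡⟨ cong ⌊_/2⌋ (two-more a m) ⟩
  suc ⌊ a + 2 * m /2⌋          ≡⟨ cong suc (⌊+2*/2⌋ a m) ⟩
  suc (⌊ a /2⌋ + m)            ≡⟨ +-suc ⌊ a /2⌋ m ⟨
  ⌊ a /2⌋ + suc m              ∎
  where
  open ≡-Reasoning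
  two-more : ∀ a m → a + 2 * suc m ≡ 2 + (a + 2 * m)
  two-more = solve-∀

digit-flip : ∀ a N → bits (a + 2^ N) N ≡ not (bits a N)
digit-flip a zero    rewrite 2^-zero | +-comm a 1 = refl
digit-flip a (suc N) rewrite 2^-suc N | ⌊+2*/2⌋ a (2^ N) = digit-flip ⌊ a /2⌋ N

-- If a ≡ b modulo 2^N but not modulo 2^(N+1), then a + 2^N ≡ b modulo 2^(N+1):
-- the N-th digits of a and b differ, and adding 2^N flips that digit of a.
mod-flip : ∀ {a b N} → a ≡ b [2^ N ] → ¬ (a ≡ b [2^ suc N ]) → a + 2^ N ≡ b [2^ suc N ]
mod-flip {a} {b} {N} ab ¬ab = mod-suc (mod-trans (mod-add-2^ a) ab) (trans (digit-flip a N) (sym digits-differ))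
  where
  digits-differ : bits b N ≡ not (bits a N)
  digits-differ = ¬-not (λ e → ¬ab (mod-suc ab (sym e)))

-- A sequence of naturals converging 2-adically: h N is correct modulo 2^N.
Coherent : (ℕ → ℕ) → Set
Coherent h = ∀ {M N} → M ≤ N → h N ≡ h M [2^ M ]

coherent-from-steps : ∀ h → (∀ k → h (suc k) ≡ h k [2^ k ]) → Coherent h
coherent-from-steps h step {M} M≤N with m≤n⇒∃[o]m+o≡n M≤N
... | d , refl = from M d
  where
  from : ∀ M d → h (M + d) ≡ h M [2^ M ]
  from M zero    = mod-≡ (cong h (+-identityʳ M))
  from M (suc d) = mod-trans (mod-≡ (cong h (+-suc M d)))
                     (mod-trans (mod-weaken (m≤m+n M d) (step (M + d))) (from M d))

lim : (ℕ → ℕ) → ℤ₂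
lim h i = bits (h (suc i)) i

trunc-lim : ∀ h → Coherent h → ∀ N → trunc (lim h) N ≡ h N [2^ N ]
trunc-lim h coherent N = mod-trans (mod-≡ (begin
  trunc (lim h) N      ≡⟨ trunc-local N (λ i i<N → digit-cong (mod-sym (coherent i<N))) ⟩
  trunc (bits (h N)) N ≡⟨ trunc-bits (h N) N ⟩
  h N % 2^ N           ∎)) (mod-% (h N))
  where open ≡-Reasoning

trunc-coherent : ∀ a → Coherent (trunc a)
trunc-coherent a = coherent-from-steps (trunc a) λ k →
  mod-trans (mod-≡ (trunc-suc a k)) (mod-add-multiple (trunc a k) (b2n (a k)))

-- Defs defines _+₂_ and _*₂_ as limits of the sums (products) of truncations, so
-- they are computed on truncations by any operation respecting congruences.
trunc-limit-op : (_∙_ : ℕ → ℕ → ℕ) →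
  (∀ {N a a′ b b′} → a ≡ a′ [2^ N ] → b ≡ b′ [2^ N ] → a ∙ b ≡ a′ ∙ b′ [2^ N ]) →
  ∀ a b N → trunc (lim (λ k → trunc a k ∙ trunc b k)) N ≡ trunc a N ∙ trunc b N [2^ N ]
trunc-limit-op _∙_ ∙-cong a b = trunc-lim (λ k → trunc a k ∙ trunc b k)
  (λ M≤N → ∙-cong (trunc-coherent a M≤N) (trunc-coherent b M≤N))

trunc-+ : ∀ a b N → trunc (a +₂ b) N ≡ trunc a N + trunc b N [2^ N ]
trunc-+ = trunc-limit-op _+_ mod-+

trunc-* : ∀ a b N → trunc (a *₂ b) N ≡ trunc a N * trunc b N [2^ N ]
trunc-* = trunc-limit-op _*_ mod-*

pattern 0F = zero
pattern 1F = suc zero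
pattern 2F = suc (suc zero)
pattern 3F = suc (suc (suc zero))

term : (Fin 4 → ℕ) → (Fin 4 → ℕ) → Fin 4 → ℕ
term U X j = U j * X j * X j

Q : (Fin 4 → ℕ) → (Fin 4 → ℕ) → ℕ
Q U X = term U X 0F + term U X 1F + term U X 2F + term U X 3F

Q-cong : ∀ {N U U′ X X′} → (∀ j → U j ≡ U′ j [2^ N ]) → (∀ j → X j ≡ X′ j [2^ N ]) →
         Q U X ≡ Q U′ X′ [2^ N ]
Q-cong {N} {U} {U′} {X} {X′} U≡ X≡ = mod-+ (mod-+ (mod-+ (term≡ 0F) (term≡ 1F)) (term≡ 2F)) (term≡ 3F)
  where
  term≡ : ∀ j → term U X j ≡ term U′ X′ j [2^ N ]
  term≡ j = mod-* (mod-* (U≡ j) (X≡ j)) (X≡ j)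

Q-cong-coeffs : ∀ {N U U′} X → (∀ j → U j ≡ U′ j [2^ N ]) → Q U X ≡ Q U′ X [2^ N ]
Q-cong-coeffs {U = U} {U′} X U≡ = Q-cong {U = U} {U′} {X} {X} U≡ (λ _ → mod-refl)

Q-cong-vector : ∀ {N} U {X X′} → (∀ j → X j ≡ X′ j [2^ N ]) → Q U X ≡ Q U X′ [2^ N ]
Q-cong-vector U {X} {X′} X≡ = Q-cong {U = U} {U} {X} {X′} (λ _ → mod-refl) X≡

truncs : (Fin 4 → ℤ₂) → ℕ → Fin 4 → ℕ
truncs x N j = trunc (x j) N

trunc-qform : ∀ u x N → trunc (qform u x) N ≡ Q (truncs u N) (truncs x N) [2^ N ]
trunc-qform u x N =
  plus (plus (plus (term≡ 0F) (term≡ 1F)) (term≡ 2F)) (term≡ 3F)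
  where
  plus : ∀ {a b a′ b′} → trunc a N ≡ a′ [2^ N ] → trunc b N ≡ b′ [2^ N ] → trunc (a +₂ b) N ≡ a′ + b′ [2^ N ]
  plus {a} {b} ea eb = mod-trans (trunc-+ a b N) (mod-+ ea eb)
  term≡ : ∀ j → trunc (u j *₂ x j *₂ x j) N ≡ term (truncs u N) (truncs x N) j [2^ N ]
  term≡ j = mod-trans (trunc-* (u j *₂ x j) (x j) N) (mod-* (trunc-* (u j) (x j) N) mod-refl)

Solves : (Fin 4 → ℤ₂) → ℤ₂ → ℕ → (Fin 4 → ℕ) → Set
Solves u α N X = Q (truncs u N) X ≡ trunc α N [2^ N ]

solves-raise : ∀ u α X {M N} → M ≤ N → Solves u α M X → Q (truncs u N) X ≡ trunc α N [2^ M ]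
solves-raise u α X M≤N sol =
  mod-trans (Q-cong-coeffs X (λ j → trunc-coherent (u j) M≤N)) (mod-trans sol (mod-sym (trunc-coherent α M≤N)))

solves-weaken : ∀ u α X {M N} → M ≤ N → Solves u α N X → Solves u α M X
solves-weaken u α X M≤N sol =
  mod-trans (Q-cong-coeffs X (λ j → mod-sym (trunc-coherent (u j) M≤N)))
            (mod-trans (mod-weaken M≤N sol) (trunc-coherent α M≤N))

solves-if-represents : ∀ u x α → qform u x ≈ α → ∀ N → Solves u α N (truncs x N)
solves-if-represents u x α rep N = mod-trans (mod-sym (trunc-qform u x N)) (mod-≡ (trunc-local N (λ i _ → rep i)))

represents-if-solves : ∀ u x α → (∀ N → Solves u α N (truncs x N)) → qform u x ≈ α
represents-if-solves u x α sol = trunc-injective λ N → trunc-eq N (mod-trans (trunc-qform u x N) (sol N))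

Odd : ℕ → Set
Odd n = ∃ λ k → n ≡ suc (2 * k)

odd-* : ∀ {m n} → Odd m → Odd n → Odd (m * n)
odd-* (a , refl) (b , refl) = a + b + 2 * a * b , product a b
  where product : ∀ a b → suc (2 * a) * suc (2 * b) ≡ suc (2 * (a + b + 2 * a * b))
        product = solve-∀

odd-+-even : ∀ {n} m → Odd n → Odd (n + 2 * m)
odd-+-even m (a , refl) = a + m , cong suc (sym (*-distribˡ-+ 2 a m))

even-isOdd : ∀ k → isOdd (2 * k) ≡ false
even-isOdd zero    = refl
even-isOdd (suc k) = trans (cong isOdd (two-more k)) (trans (not-involutive (isOdd (2 * k))) (even-isOdd k))
  where two-more : ∀ k → 2 * suc k ≡ 2 + 2 * k
        two-more = solve-∀

odd-isOdd : ∀ {n} → Odd n → isOdd n ≡ true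
odd-isOdd (k , refl) = cong not (even-isOdd k)

unit-trunc-odd : ∀ a → IsUnit a → ∀ N → Odd (trunc a (suc N))
unit-trunc-odd a unit N rewrite unit = trunc (λ i → a (suc i)) N , refl

bump : Fin 4 → ℕ → (Fin 4 → ℕ) → Fin 4 → ℕ
bump i d X = updateAt X i (_+ d)

bump-close : ∀ i N X j → bump i (2^ N) X j ≡ X j [2^ N ]
bump-close i N X j with i ≟ᶠ j
... | yes refl = mod-trans (mod-≡ (updateAt-updates i X)) (mod-add-2^ (X i))
... | no i≢j   = mod-≡ (updateAt-minimal j i X (i≢j ∘ sym))

Q-bump : ∀ U X i d → Q U (bump i d X) ≡ Q U X + U i * (2 * X i * d + d * d)
Q-bump U X 0F d = shift (U 0F) (X 0F) d (term U X 1F) (term U X 2F) (term U X 3F)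
  where shift : ∀ u x d a b c → u * (x + d) * (x + d) + a + b + c ≡ u * x * x + a + b + c + u * (2 * x * d + d * d)
        shift = solve-∀
Q-bump U X 1F d = shift (U 1F) (X 1F) d (term U X 0F) (term U X 2F) (term U X 3F)
  where shift : ∀ u x d a b c → a + u * (x + d) * (x + d) + b + c ≡ a + u * x * x + b + c + u * (2 * x * d + d * d)
        shift = solve-∀
Q-bump U X 2F d = shift (U 2F) (X 2F) d (term U X 0F) (term U X 1F) (term U X 3F)
  where shift : ∀ u x d a b c → a + b + u * (x + d) * (x + d) + c ≡ a + b + u * x * x + c + u * (2 * x * d + d * d)
        shift = solve-∀
Q-bump U X 3F d = shift (U 3F) (X 3F) d (term U X 0F) (term U X 1F) (term U X 2F)
  where shift : ∀ u x d a b c → a + b + c + u * (x + d) * (x + d) ≡ a + b + c + u * x * x + u * (2 * x * d + d * d)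
        shift = solve-∀

-- Adding
-- 2^(2+k) to X i changes Q U X by U i X i 2^(3+k) + U i 2^(4+2k) ≡ 2^(3+k) modulo 2^(4+k);
-- so either X already solves it modulo 2^(4+k), or the bumped vector does (`mod-flip`).
hensel-step : ∀ k U A i X → Odd (U i) → Odd (X i) → Q U X ≡ A [2^ (3 + k) ] →
  Σ (Fin 4 → ℕ) λ X′ → Q U X′ ≡ A [2^ (4 + k) ] × Odd (X′ i) × (∀ j → X′ j ≡ X j [2^ (2 + k) ])
hensel-step k U A i X oddU oddX sol with mod-eq? (Q U X) A
... | yes sol′ = X , sol′ , oddX , λ _ → mod-refl
... | no ¬sol′ = bump i d X , bumped-solves , bumped-odd , bump-close i (2 + k) X
  where
  open ≡-Reasoning
  t d c : ℕ
  t = 2^ k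
  d = 2^ (2 + k)
  c = proj₁ (odd-* oddU oddX)       -- U i * X i = 1 + 2c

  scale : ∀ m {n} → 2^ m ≡ n → 2^ (m + k) ≡ n * t
  scale m e = trans (2^-+ m k) (cong (_* t) e)

  increment : Q U (bump i d X) ≡ Q U X + 2^ (3 + k) + 2^ (4 + k) * (c + U i * t)
  increment = begin
    Q U (bump i d X)                                       ≡⟨ Q-bump U X i d ⟩
    Q U X + U i * (2 * X i * d + d * d)                    ≡⟨ cong (λ e → Q U X + U i * (2 * X i * e + e * e))
                                                                     (scale 2 2^2≡4) ⟩
    Q U X + U i * (2 * X i * (4 * t) + 4 * t * (4 * t))    ≡⟨ cong (Q U X +_) (expand (U i) (X i) t) ⟩
    Q U X + (8 * t * (U i * X i) + 16 * t * (U i * t))     ≡⟨ cong (λ e → Q U X + (8 * t * e + 16 * t * (U i * t)))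
                                                                     (proj₂ (odd-* oddU oddX)) ⟩
    Q U X + (8 * t * suc (2 * c) + 16 * t * (U i * t))     ≡⟨ regroup (Q U X) (U i * t) t c ⟩
    Q U X + 8 * t + 16 * t * (c + U i * t)                 ≡⟨ cong₂ (λ p q → Q U X + p + q * (c + U i * t))
                                                                     (scale 3 2^3≡8) (scale 4 2^4≡16) ⟨
    Q U X + 2^ (3 + k) + 2^ (4 + k) * (c + U i * t)        ∎
    where
    expand : ∀ u x t → u * (2 * x * (4 * t) + 4 * t * (4 * t)) ≡ 8 * t * (u * x) + 16 * t * (u * t)
    expand = solve-∀
    regroup : ∀ q s t c → q + (8 * t * suc (2 * c) + 16 * t * s) ≡ q + 8 * t + 16 * t * (c + s)
    regroup = solve-∀

  bumped-solves : Q U (bump i d X) ≡ A [2^ (4 + k) ]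
  bumped-solves = mod-trans (mod-≡ increment) (mod-trans (mod-add-multiple _ (c + U i * t)) (mod-flip sol ¬sol′))

  bumped-odd : Odd (bump i d X i)
  bumped-odd = subst Odd (sym (trans (updateAt-updates i X) (cong (X i +_) (2^-suc (1 + k)))))
                         (odd-+-even (2^ (1 + k)) oddX)

module HenselLift (u : Fin 4 → ℤ₂) (α : ℤ₂) (i : Fin 4) (unit : IsUnit (u i))
                  (X₀ : Fin 4 → ℕ) (odd₀ : Odd (X₀ i)) (sol₀ : Solves u α 3 X₀) where

  Approx : ℕ → Set
  Approx k = Σ (Fin 4 → ℕ) λ X → Solves u α (3 + k) X × Odd (X i)

  refine : ∀ k → ((X , _) : Approx k) →
           Σ (Fin 4 → ℕ) λ X′ → Solves u α (4 + k) X′ × Odd (X′ i) × (∀ j → X′ j ≡ X j [2^ (2 + k) ])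
  refine k (X , sol , oddX) = hensel-step k (truncs u (4 + k)) (trunc α (4 + k)) i X
    (unit-trunc-odd (u i) unit (3 + k)) oddX (solves-raise u α X (n≤1+n (3 + k)) sol)

  approx : ∀ k → Approx k
  approx zero    = X₀ , sol₀ , odd₀
  approx (suc k) = let (X′ , sol′ , odd′ , _) = refine k (approx k) in X′ , sol′ , odd′

  coordinate : Fin 4 → ℕ → ℕ
  coordinate j k = proj₁ (approx k) j

  coordinate-coherent : ∀ j → Coherent (coordinate j)
  coordinate-coherent j = coherent-from-steps (coordinate j) λ k →
    mod-weaken (≤-trans (n≤1+n k) (n≤1+n (1 + k))) (proj₂ (proj₂ (proj₂ (refine k (approx k)))) j)

  x : Fin 4 → ℤ₂
  x j = lim (coordinate j)

  x-represents : qform u x ≈ α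
  x-represents = represents-if-solves u x α λ N →
    mod-trans (Q-cong-vector (truncs u N) (λ j → trunc-lim (coordinate j) (coordinate-coherent j) N))
              (solves-weaken u α (proj₁ (approx N)) (m≤n+m N 3) (proj₁ (proj₂ (approx N))))

  x-unit : IsUnit (x i)
  x-unit = odd-isOdd (proj₂ (proj₂ (approx 1)))

residue8 : Bool → Bool → Bool → ℕ
residue8 b₀ b₁ b₂ = b2n b₀ + 2 * (b2n b₁ + 2 * (b2n b₂ + 2 * 0))

trunc-3 : ∀ α {b₀ b₁ b₂} → α 0 ≡ b₀ → α 1 ≡ b₁ → α 2 ≡ b₂ → trunc α 3 ≡ residue8 b₀ b₁ b₂
trunc-3 α refl refl refl = refl

vec4 : ℕ → ℕ → ℕ → ℕ → Fin 4 → ℕ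
vec4 a b c d 0F = a
vec4 a b c d 1F = b
vec4 a b c d 2F = c
vec4 a b c d 3F = d

small-vectors : List (Fin 4 → ℕ)
small-vectors = concatMap (λ a → concatMap (λ b → concatMap (λ c → map (vec4 a b c) small) small) small) small
  where
  small : List ℕ
  small = 0 ∷ 1 ∷ 2 ∷ []

Solution8 : (Fin 4 → ℕ) → ℕ → (Fin 4 → ℕ) → Set
Solution8 U A X = (∃ λ i → X i ≡ 1) × Q U X % 8 ≡ A % 8

solution8? : ∀ U A X → Dec (Solution8 U A X)
solution8? U A X = any? (λ i → X i ≟ 1) ×-dec (Q U X % 8 ≟ A % 8)

all-bools? : {P : Bool → Set} → (∀ b → Dec (P b)) → Dec (∀ b → P b)
all-bools? P? with P? false | P? true
... | yes p | yes q = yes λ { false → p ; true → q }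
... | no ¬p | _     = no λ all → ¬p (all false)
... | yes _ | no ¬q = no λ all → ¬q (all true)

NotDiv4 : ℤ₂ → Set
NotDiv4 α = T (α 0 ∨ α 1)

classify4 : ∀ α → NotDiv4 α ⊎ (α 0 ≡ false × α 1 ≡ false)
classify4 α with α 0 | α 1
... | true  | _     = inj₁ tt
... | false | true  = inj₁ tt
... | false | false = inj₂ (refl , refl)

odd-coeffs8 : Bool → Bool → Bool → Bool → Bool → Bool → Bool → Bool → Fin 4 → ℕ
odd-coeffs8 p₁ p₂ q₁ q₂ r₁ r₂ s₁ s₂ =
  vec4 (residue8 true p₁ p₂) (residue8 true q₁ q₂) (residue8 true r₁ r₂) (residue8 true s₁ s₂)

Check8 : Set
Check8 = ∀ p₁ p₂ q₁ q₂ r₁ r₂ s₁ s₂ a₀ a₁ a₂ → T (a₀ ∨ a₁) →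
  Any (Solution8 (odd-coeffs8 p₁ p₂ q₁ q₂ r₁ r₂ s₁ s₂) (residue8 a₀ a₁ a₂)) small-vectors

-- decided by evaluation; opaque so that uses of `check8` never unfold the decision
opaque
  check8 : Check8
  check8 = from-yes (all-bools? λ p₁ → all-bools? λ p₂ → all-bools? λ q₁ → all-bools? λ q₂ →
    all-bools? λ r₁ → all-bools? λ r₂ → all-bools? λ s₁ → all-bools? λ s₂ →
    all-bools? λ a₀ → all-bools? λ a₁ → all-bools? λ a₂ → T? (a₀ ∨ a₁) →-dec
    any-in? (solution8? (odd-coeffs8 p₁ p₂ q₁ q₂ r₁ r₂ s₁ s₂) (residue8 a₀ a₁ a₂)) small-vectors)

-- the finite check speaks of residues modulo the literal 8
mod-8 : ∀ {a b} → a % 8 ≡ b % 8 → a ≡ b [2^ 3 ]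
mod-8 e = mod-eq (trans (%-congʳ 2^3≡8) (trans e (sym (%-congʳ 2^3≡8))))

OddSolution8 : (Fin 4 → ℤ₂) → ℤ₂ → Set
OddSolution8 u α = Σ (Fin 4) λ i → Σ (Fin 4 → ℕ) λ X → Odd (X i) × Solves u α 3 X

odd-solution8 : ∀ u → (∀ j → IsUnit (u j)) → ∀ α → NotDiv4 α → OddSolution8 u α
odd-solution8 u units α 4∤α = from-check (satisfied (check8
  (u 0F 1) (u 0F 2) (u 1F 1) (u 1F 2) (u 2F 1) (u 2F 2) (u 3F 1) (u 3F 2) (α 0) (α 1) (α 2) 4∤α))
  where
  U : Fin 4 → ℕ
  U j = residue8 true (u j 1) (u j 2)
  coeffs-mod8 : ∀ j → truncs u 3 j ≡ U j [2^ 3 ]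
  coeffs-mod8 j = mod-≡ (cong (λ b → residue8 b (u j 1) (u j 2)) (units j))
  from-check : ∃ (Solution8 (odd-coeffs8 (u 0F 1) (u 0F 2) (u 1F 1) (u 1F 2) (u 2F 1) (u 2F 2) (u 3F 1) (u 3F 2))
                            (trunc α 3))
             → OddSolution8 u α
  from-check (X , (i , Xi≡1) , sol) = i , X , (0 , Xi≡1) , mod-trans (Q-cong-coeffs X coeffs-mod8) (mod-8 sol)

lift-odd-solution : ∀ u → (∀ j → IsUnit (u j)) → ∀ α → OddSolution8 u α → PrimRepresents u α
lift-odd-solution u units α (i , X , oddX , sol) = x , (i , x-unit) , x-represents
  where open HenselLift u α i (units i) X oddX sol

primitive-rep-4∤ : ∀ u → (∀ j → IsUnit (u j)) → ∀ α → NotDiv4 α → PrimRepresents u α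
primitive-rep-4∤ u units α 4∤α = lift-odd-solution u units α (odd-solution8 u units α 4∤α)

primitive-rep-mod8 : ∀ u → (∀ j → IsUnit (u j)) → ∀ α {β} → PrimRepresents u β → trunc α 3 ≡ trunc β 3 →
                     PrimRepresents u α
primitive-rep-mod8 u units α {β} (y , (i , yi-unit) , rep) α≡β =
  lift-odd-solution u units α (i , truncs y 3 , unit-trunc-odd (y i) yi-unit 2 ,
    mod-trans (solves-if-represents u y β rep 3) (mod-≡ (sym α≡β)))

quarter : ℤ₂ → ℤ₂
quarter α i = α (2 + i)

Q-zero : ∀ U → Q U (λ _ → 0) ≡ 0
Q-zero U = identity (U 0F) (U 1F) (U 2F) (U 3F)
  where identity : ∀ a b c d → a * 0 * 0 + b * 0 * 0 + c * 0 * 0 + d * 0 * 0 ≡ 0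
        identity = solve-∀

Q-double : ∀ U Y → Q U (λ j → 2 * Y j) ≡ 4 * Q U Y
Q-double U Y = identity (U 0F) (U 1F) (U 2F) (U 3F) (Y 0F) (Y 1F) (Y 2F) (Y 3F)
  where identity : ∀ a b c d y₀ y₁ y₂ y₃ →
          a * (2 * y₀) * (2 * y₀) + b * (2 * y₁) * (2 * y₁) + c * (2 * y₂) * (2 * y₂) + d * (2 * y₃) * (2 * y₃)
          ≡ 4 * (a * y₀ * y₀ + b * y₁ * y₁ + c * y₂ * y₂ + d * y₃ * y₃)
        identity = solve-∀

solves-quadruple : ∀ u {α M} Y → α 0 ≡ false → α 1 ≡ false →
  Q (truncs u (2 + M)) Y ≡ trunc (quarter α) M [2^ M ] → Solves u α (2 + M) (λ j → 2 * Y j)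
solves-quadruple u {α} {M} Y e₀ e₁ sol =
  mod-trans (mod-≡ (Q-double (truncs u (2 + M)) Y)) (mod-trans (mod-4* sol) (mod-≡ (sym α≡4α/4)))
  where
  α≡4α/4 : trunc α (2 + M) ≡ 4 * trunc (quarter α) M
  α≡4α/4 = trans (cong₂ (λ b c → b2n b + 2 * (b2n c + 2 * trunc (quarter α) M)) e₀ e₁)
                 (sym (*-assoc 2 2 (trunc (quarter α) M)))

-- Universality by descent: α ≢ 0 (mod 4) is represented by Hensel's lemma, and
-- α ≡ 0 (mod 4) is represented by 2y where y represents α/4.  The vector is built
-- digit by digit, so the recursion is on the digit index.
module Descent (u : Fin 4 → ℤ₂) (units : ∀ j → IsUnit (u j)) where

  descent : (α : ℤ₂) → NotDiv4 α ⊎ (α 0 ≡ false × α 1 ≡ false) → Fin 4 → ℤ₂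
  descent α (inj₁ 4∤α) = proj₁ (primitive-rep-4∤ u units α 4∤α)
  descent α (inj₂ _) j zero    = false
  descent α (inj₂ _) j (suc d) = descent (quarter α) (classify4 (quarter α)) j d

  descent-solves : ∀ N α c → Solves u α N (truncs (descent α c) N)
  descent-solves N α (inj₁ 4∤α) = solves-if-represents u (proj₁ rep) α (proj₂ (proj₂ rep)) N
    where
    rep : PrimRepresents u α
    rep = primitive-rep-4∤ u units α 4∤α
  descent-solves zero α (inj₂ _) = mod-zero _ _
  descent-solves (suc zero) α (inj₂ (e₀ , _)) = mod-≡ step
    where
    step : Q (truncs u 1) (λ _ → 0) ≡ trunc α 1
    step = trans (Q-zero (truncs u 1)) (cong (λ b → b2n b + 2 * 0) (sym e₀))
  descent-solves (suc (suc M)) α (inj₂ (e₀ , e₁)) = solves-quadruple u {α} Y e₀ e₁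
    (mod-trans (Q-cong {U = truncs u (2 + M)} {truncs u M} {Y} {truncs y M}
                       (λ j → trunc-coherent (u j) (m≤n+m M 2)) (λ j → trunc-coherent (y j) (n≤1+n M)))
               (descent-solves M (quarter α) (classify4 (quarter α))))
    where
    y : Fin 4 → ℤ₂
    y = descent (quarter α) (classify4 (quarter α))
    Y : Fin 4 → ℕ
    Y = truncs y (suc M)

universal : ∀ u → (∀ j → IsUnit (u j)) → Universal u
universal u units α = descent α (classify4 α) ,
  represents-if-solves u (descent α (classify4 α)) α (λ N → descent-solves N α (classify4 α))
  where open Descent u units

-- with unit coefficients, if 4 and 8 are primitively represented then so is every α:
-- either α ≢ 0 (mod 4), or α is congruent to 4 or to 8 modulo 8
primitive-from-4-and-8 : ∀ u → (∀ j → IsUnit (u j)) →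
  PrimRepresents u (fromℕ 4) → PrimRepresents u (fromℕ 8) → ∀ α → PrimRepresents u α
primitive-from-4-and-8 u units rep4 rep8 α = by-cases (classify4 α) (α 2) refl
  where
  by-cases : NotDiv4 α ⊎ (α 0 ≡ false × α 1 ≡ false) → ∀ b₂ → α 2 ≡ b₂ → PrimRepresents u α
  by-cases (inj₁ 4∤α)       _     _  = primitive-rep-4∤ u units α 4∤α
  by-cases (inj₂ (e₀ , e₁)) true  e₂ = primitive-rep-mod8 u units α rep4 (trunc-3 α e₀ e₁ e₂)
  by-cases (inj₂ (e₀ , e₁)) false e₂ = primitive-rep-mod8 u units α rep8 (trunc-3 α e₀ e₁ e₂)

proposition5p5 : (L : Units4) →
    Universal (proj₁ L) ×
    (PrimUniversal (proj₁ L) ⇔ (PrimRepresents (proj₁ L) (fromℕ 4) × PrimRepresents (proj₁ L) (fromℕ 8)))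
proposition5p5 (u , units) = universal u units , mk⇔ necessary sufficient
  where
  necessary : PrimUniversal u → PrimRepresents u (fromℕ 4) × PrimRepresents u (fromℕ 8)
  necessary prim = prim (fromℕ 4) (2 , refl) , prim (fromℕ 8) (3 , refl)
  sufficient : PrimRepresents u (fromℕ 4) × PrimRepresents u (fromℕ 8) → PrimUniversal u
  sufficient (rep4 , rep8) α _ = primitive-from-4-and-8 u units rep4 rep8 α
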